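{- Let $\ell,\beta$ be positive integers and $a=(a_{ij}),b=(b_{ij})\in\{0,1\}^{\ell\times\ell}$, and let $G=G(\ell,\beta)$ be the directed graph described in the context. For all $1\leq i,r\leq\ell$ and $1\leq j,s\leq\beta$: if at least one of the edges $(x^1_i,x^2_r)$, $(y^1_i,y^2_r)$ is in $G$, then there is a directed path of length 5 from $x_{ij}$ to $y_{rs}$ that contains no edge of $D$; otherwise, the only directed path from $x_{ij}$ to $y_{rs}$ in $G$ is the one consisting of the single edge $(x_{ij},y_{rs})$.
   Context: The directed graph $G(\ell,\beta)$ has vertices $x^1_i,x^2_i,y^1_i,y^2_i,y^3_i$ for $1\leq i\leq\ell$ and $x_{ij},y_{ij}$ for $1\leq i\leq\ell$, $1\leq j\leq\beta$. Its directed edges are: $(x^1_i,y^1_i)$ and $(x^2_i,y^2_i)$ for all $i$; the set $D$ of all edges $(x_{ij},y_{rs})$ for all $1\leq i,r\leq\ell$, $1\leq j,s\leq\beta$; $(x_{ij},x^1_i)$ for all $i,j$; $(y^3_i,y_{ij})$ for all $i,j$; $(y^2_i,y^3_i)$ for all $i$; the edge $(x^1_i,x^2_j)$ if and only if $a_{ij}=0$; and the edge $(y^1_i,y^2_j)$ if and only if $b_{ij}=0$. -}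

module Defs where

open import Data.Nat using (ℕ; zero; suc)
open import Data.Fin using (Fin) renaming (zero to zero′)
open import Data.Unit using (⊤)
open import Data.List using (List; []; _∷_)
open import Data.List.Relation.Unary.Unique.Propositional using (Unique)
open import Data.Product using (∃; _×_; _,_)
open import Relation.Binary.PropositionalEquality using (_≡_)
open import Relation.Nullary using (¬_)

Mat01 : ℕ → Set
Mat01 ℓ = Fin ℓ → Fin ℓ → Fin 2

data V (ℓ β : ℕ) : Set where
  x¹ x² y¹ y² y³ : Fin ℓ → V ℓ β
  x y : Fin ℓ → Fin β → V ℓ β

data Edge {ℓ β : ℕ} (a b : Mat01 ℓ) : V ℓ β → V ℓ β → Set where
  e-x¹y¹ : ∀ i → Edge a b (x¹ i) (y¹ i)
  e-x²y² : ∀ i → Edge a b (x² i) (y² i)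
  e-D    : ∀ i j r s → Edge a b (x i j) (y r s)
  e-xx¹  : ∀ i j → Edge a b (x i j) (x¹ i)
  e-y³y  : ∀ i j → Edge a b (y³ i) (y i j)
  e-y²y³ : ∀ i → Edge a b (y² i) (y³ i)
  e-x¹x² : ∀ i j → a i j ≡ zero′ → Edge a b (x¹ i) (x² j)
  e-y¹y² : ∀ i j → b i j ≡ zero′ → Edge a b (y¹ i) (y² j)

InD : ∀ {ℓ β} → V ℓ β → V ℓ β → Set
InD {ℓ} {β} u v = ∃ λ (i : Fin ℓ) → ∃ λ (j : Fin β) → ∃ λ (r : Fin ℓ) → ∃ λ (s : Fin β) →
  (u ≡ x i j) × (v ≡ y r s)

data Walk {ℓ β : ℕ} (a b : Mat01 ℓ) : V ℓ β → V ℓ β → ℕ → Set where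
  []  : ∀ {u} → Walk a b u u zero
  _∷_ : ∀ {u v w n} → Edge a b u v → Walk a b v w n → Walk a b u w (suc n)

vertices : ∀ {ℓ β} {a b : Mat01 ℓ} {u w : V ℓ β} {n} → Walk a b u w n → List (V ℓ β)
vertices {u = u} [] = u ∷ []
vertices {u = u} (_ ∷ p) = u ∷ vertices p

IsPath : ∀ {ℓ β} {a b : Mat01 ℓ} {u w : V ℓ β} {n} → Walk a b u w n → Set
IsPath p = Unique (vertices p)

AvoidsD : ∀ {ℓ β} {a b : Mat01 ℓ} {u w : V ℓ β} {n} → Walk a b u w n → Set
AvoidsD [] = ⊤
AvoidsD {u = u} (_∷_ {v = v} _ p) = ¬ InD u v × AvoidsD p

-- Every edge of G raises the rank x < x¹ < x², y¹ < y² < y³ < y, so every walk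
-- is a path, and a walk can use an edge of D only as its first edge, since no edge enters an
-- x-vertex.  A walk from x_ij to y_rs other than the D-edge must therefore be
-- x_ij → x¹_i → (x²_r or y¹_i) → y²_r → y³_r → y_rs, which exists exactly when
-- one of the edges (x¹_i, x²_r), (y¹_i, y²_r) is present.
module Submission where

open import Defs
open import Data.Nat using (ℕ; _≤_; _<_; z<s)
open import Data.Nat.Properties using (≤-refl; ≤-trans; <⇒≤; <-≤-trans; <⇒≢; n<1+n)
open import Data.Fin using (Fin)
open import Data.List using ([]; _∷_)
open import Data.List.Relation.Unary.All as All using (All; []; _∷_)
open import Data.List.Relation.Unary.AllPairs using ([]; _∷_)
open import Data.Product using (∃; _×_; _,_)
open import Data.Sum using (_⊎_; inj₁; inj₂)
open import Data.Empty using (⊥-elim)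
open import Data.Unit using (tt)
open import Relation.Binary.PropositionalEquality using (_≡_; _≢_; refl; cong)
open import Relation.Nullary using (¬_)

rank : ∀ {ℓ β} → V ℓ β → ℕ
rank (x _ _) = 0
rank (x¹ _)  = 1
rank (x² _)  = 2
rank (y¹ _)  = 2
rank (y² _)  = 3
rank (y³ _)  = 4
rank (y _ _) = 5

module _ {ℓ β : ℕ} {a b : Mat01 ℓ} where

  edge-rank-< : ∀ {u v : V ℓ β} → Edge a b u v → rank u < rank v
  edge-rank-< (e-x¹y¹ _)     = n<1+n 1
  edge-rank-< (e-x²y² _)     = n<1+n 2
  edge-rank-< (e-D _ _ _ _)  = z<s
  edge-rank-< (e-xx¹ _ _)    = n<1+n 0
  edge-rank-< (e-y³y _ _)    = n<1+n 4
  edge-rank-< (e-y²y³ _)     = n<1+n 3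
  edge-rank-< (e-x¹x² _ _ _) = n<1+n 1
  edge-rank-< (e-y¹y² _ _ _) = n<1+n 2

  walk-rank-≥ : ∀ {u w : V ℓ β} {n} (p : Walk a b u w n) → All (λ v → rank u ≤ rank v) (vertices p)
  walk-rank-≥ []      = ≤-refl ∷ []
  walk-rank-≥ (e ∷ p) = ≤-refl ∷ All.map (≤-trans (<⇒≤ (edge-rank-< e))) (walk-rank-≥ p)

  walk-isPath : ∀ {u w : V ℓ β} {n} (p : Walk a b u w n) → IsPath p
  walk-isPath []      = [] ∷ []
  walk-isPath (e ∷ p) =
    All.map (λ rv≤rw → ≢-by-rank (<-≤-trans (edge-rank-< e) rv≤rw)) (walk-rank-≥ p) ∷ walk-isPath p
    where
      ≢-by-rank : ∀ {u w : V ℓ β} → rank u < rank w → u ≢ w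
      ≢-by-rank lt u≡w = <⇒≢ lt (cong rank u≡w)

  no-edge-into-x : ∀ {u : V ℓ β} {i j} → ¬ Edge a b u (x i j)
  no-edge-into-x ()

  avoidsD-from-non-x : ∀ {u w : V ℓ β} {n} → (∀ i j → u ≢ x i j) → (p : Walk a b u w n) → AvoidsD p
  avoidsD-from-non-x u≢x []      = tt
  avoidsD-from-non-x u≢x (e ∷ p) =
    (λ { (i , j , _ , _ , u≡x , _) → u≢x i j u≡x }) ,
    avoidsD-from-non-x (λ { _ _ refl → no-edge-into-x e }) p

  Bridge : Fin ℓ → Fin ℓ → Set
  Bridge i r = Edge {ℓ} {β} a b (x¹ i) (x² r) ⊎ Edge {ℓ} {β} a b (y¹ i) (y² r)

  bridge-tail : ∀ {i r s} → Bridge i r → Walk a b (x¹ i) (y r s) 4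
  bridge-tail {i} {r} {s} (inj₁ e) = e ∷ e-x²y² r ∷ e-y²y³ r ∷ e-y³y r s ∷ []
  bridge-tail {i} {r} {s} (inj₂ e) = e-x¹y¹ i ∷ e ∷ e-y²y³ r ∷ e-y³y r s ∷ []

  bridge-walk : ∀ {i r j s} → Bridge i r → Walk a b (x i j) (y r s) 5
  bridge-walk {i} {j = j} br = e-xx¹ i j ∷ bridge-tail br

  bridge-walk-avoidsD : ∀ {i r j s} (br : Bridge i r) → AvoidsD (bridge-walk {i} {r} {j} {s} br)
  bridge-walk-avoidsD br =
    (λ { (_ , _ , _ , _ , _ , ()) }) , avoidsD-from-non-x (λ { _ _ () }) (bridge-tail br)

  x-y-walk-direct-or-bridge : ∀ {i r j s n} (p : Walk a b (x i j) (y r s) n) →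
    vertices p ≡ x i j ∷ y r s ∷ [] ⊎ Bridge i r
  x-y-walk-direct-or-bridge (e-D _ _ _ _ ∷ []) = inj₁ refl
  x-y-walk-direct-or-bridge (e-D _ _ _ _ ∷ () ∷ _)
  x-y-walk-direct-or-bridge (e-xx¹ _ _ ∷ e@(e-x¹x² _ _ _) ∷ e-x²y² _ ∷ e-y²y³ _ ∷ e-y³y _ _ ∷ []) = inj₂ (inj₁ e)
  x-y-walk-direct-or-bridge (e-xx¹ _ _ ∷ e-x¹y¹ _ ∷ e@(e-y¹y² _ _ _) ∷ e-y²y³ _ ∷ e-y³y _ _ ∷ []) = inj₂ (inj₂ e)
  x-y-walk-direct-or-bridge (e-xx¹ _ _ ∷ e-x¹x² _ _ _ ∷ e-x²y² _ ∷ e-y²y³ _ ∷ e-y³y _ _ ∷ () ∷ _)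
  x-y-walk-direct-or-bridge (e-xx¹ _ _ ∷ e-x¹y¹ _ ∷ e-y¹y² _ _ _ ∷ e-y²y³ _ ∷ e-y³y _ _ ∷ () ∷ _)

claim5 : (ℓ β : ℕ) → (a b : Mat01 ℓ) → (i r : Fin ℓ) → (j s : Fin β) →
    ((Edge {ℓ} {β} a b (x¹ i) (x² r) ⊎ Edge {ℓ} {β} a b (y¹ i) (y² r)) →
      ∃ λ (p : Walk a b (x i j) (y r s) 5) → IsPath p × AvoidsD p)
    × (¬ (Edge {ℓ} {β} a b (x¹ i) (x² r) ⊎ Edge {ℓ} {β} a b (y¹ i) (y² r)) →
      ∀ (n : ℕ) (p : Walk a b (x i j) (y r s) n) → IsPath p →
        vertices p ≡ x i j ∷ y r s ∷ [])
claim5 ℓ β a b i r j s = bridge-path , only-D-edge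
  where
    bridge-path : Bridge i r → ∃ λ (p : Walk a b (x i j) (y r s) 5) → IsPath p × AvoidsD p
    bridge-path br = bridge-walk br , walk-isPath (bridge-walk br) , bridge-walk-avoidsD br

    only-D-edge : ¬ Bridge i r → ∀ n (p : Walk a b (x i j) (y r s) n) → IsPath p →
                  vertices p ≡ x i j ∷ y r s ∷ []
    only-D-edge no-bridge n p _ with x-y-walk-direct-or-bridge p
    ... | inj₁ direct = direct
    ... | inj₂ br     = ⊥-elim (no-bridge br)
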